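{- The scheme $\mathrm{Iab}_C\varphi\rightarrow[\overline{C}]\neg\varphi$ is not valid: there exist a finite non-empty set of agents $N$, a coalition $C\subseteq N$, a formula $\varphi$, a coalition model $\mathcal{M}$ over $N$ and a state $s$ with $\mathcal{M},s\models\mathrm{Iab}_C\varphi$ and $\mathcal{M},s\not\models[\overline{C}]\neg\varphi$.
   Context: A coalition is any $C\subseteq N$, $\overline{C}=N\setminus C$. Formulas: $\varphi ::= p \mid \neg\varphi \mid (\varphi\wedge\psi) \mid [C]\varphi \mid \mathrm{Iab}_C\varphi$ over a countable set $\mathrm{Prop}$ of variables. A coalition model is $\mathcal{M}=(S,\{Act_i\}_{i\in N},o,V)$ with $S$ non-empty, each $Act_i$ non-empty, $o:S\times\prod_{i\in N}Act_i\to S$, $V:\mathrm{Prop}\to 2^S$; $Act_C=\prod_{i\in C}Act_i$ ($Act_\emptyset$ contains only the empty profile). $\mathcal{M},s\models[C]\varphi$ iff there is $\sigma_C\in Act_C$ such that for all $\sigma_{\overline{C}}\in Act_{\overline{C}}$, $\mathcal{M},o(s,\sigma_C,\sigma_{\overline{C}})\models\varphi$; $\mathcal{M},s\models\mathrm{Iab}_C\varphi$ iff $\mathcal{M},s\not\models[C]\varphi$; atoms and Boolean connectives as usual. -}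

module Defs where

open import Data.Nat using (ℕ)
open import Data.Fin using (Fin; zero; suc)
open import Data.Bool using (Bool; true; false; not)
open import Data.Vec using (Vec; lookup; _∷_)
open import Data.Product using (Σ; _×_; _,_)
open import Data.Sum using (_⊎_)
open import Relation.Nullary using (¬_)
open import Relation.Binary.PropositionalEquality using (_≡_; refl)
open import Data.Fin.Subset using (Subset; ∁)

Coalition : ℕ → Set
Coalition n = Subset n

Prop : Set
Prop = ℕ

data Formula (n : ℕ) : Set where
  var : Prop → Formula n
  ¬'_ : Formula n → Formula n
  _∧'_ : Formula n → Formula n → Formula n
  [_]_ : Coalition n → Formula n → Formula n
  Iab : Coalition n → Formula n → Formula n

record CoalitionModel (n : ℕ) : Set₁ where
  field
    S    : Set
    s₀   : S                      -- witnesses S non-empty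
    Act  : Fin n → Set
    act₀ : (i : Fin n) → Act i    -- witnesses each Act_i non-empty
    o    : S → ((i : Fin n) → Act i) → S
    V    : Prop → S → Set

∁-lookup : ∀ {m} (D : Subset m) (k : Fin m) → lookup D k ≡ false → lookup (∁ D) k ≡ true
∁-lookup (false ∷ D) zero e = refl
∁-lookup (x ∷ D) (suc k) e = ∁-lookup D k e

module _ {n : ℕ} (M : CoalitionModel n) where
  open CoalitionModel M

  ActC : Coalition n → Set
  ActC C = (i : Fin n) → lookup C i ≡ true → Act i

  merge : (C : Coalition n) → ActC C → ActC (∁ C) → (i : Fin n) → Act i
  merge C σ τ i with lookup C i in eq
  ... | true  = σ i eq
  ... | false = τ i (∁-lookup C i eq)

  _⊨_ : S → Formula n → Set
  s ⊨ var p = V p s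
  s ⊨ (¬' φ) = ¬ (s ⊨ φ)
  s ⊨ (φ ∧' ψ) = (s ⊨ φ) × (s ⊨ ψ)
  s ⊨ ([ C ] φ) = Σ (ActC C) λ σ → (τ : ActC (∁ C)) → o s (merge C σ τ) ⊨ φ
  s ⊨ Iab C φ = ¬ (Σ (ActC C) λ σ → (τ : ActC (∁ C)) → o s (merge C σ τ) ⊨ φ)

module Submission where

open import Defs
open import Data.Nat using (ℕ; _≥_; s≤s; z≤n)
open import Data.Product using (Σ; _×_; _,_)
open import Relation.Nullary using (¬_)
open import Data.Fin.Subset using (∁)
open import Data.Fin using (zero; suc)
open import Data.Bool using (Bool; true; false; not; _xor_)
open import Data.Bool.Properties using (not-¬)
open import Data.Vec using (_∷_; [])
open import Relation.Binary.PropositionalEquality using (_≡_; refl)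

-- Two agents each pick a bit and the next state is their xor, so whoever
-- moves second decides the outcome.  Hence agent 0 alone cannot force p, and
-- agent 1 alone cannot force ¬p either: inability of C is not ability of C̄.

xor-model : CoalitionModel 2
xor-model = record
  { S    = Bool
  ; s₀   = false
  ; Act  = λ _ → Bool
  ; act₀ = λ _ → false
  ; o    = λ _ a → a zero xor a (suc zero)
  ; V    = λ _ s → s ≡ true
  }

open CoalitionModel xor-model using (S)

first : Coalition 2
first = true ∷ false ∷ []

true-state : Formula 2
true-state = var 0

xor-not-self≡true : ∀ b → not b xor b ≡ true
xor-not-self≡true true  = refl
xor-not-self≡true false = refl

xor-self≡false : ∀ b → b xor b ≡ false
xor-self≡false true  = refl
xor-self≡false false = refl

first-unable-true-state : ∀ (s : S) → _⊨_ xor-model s (Iab first true-state)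
first-unable-true-state _ (σ , forces) =
  not-¬ (xor-self≡false (σ zero refl)) (forces copy-first)
  where
  copy-first : ActC xor-model (∁ first)
  copy-first zero ()
  copy-first (suc zero) _ = σ zero refl

second-unable-false-state : ∀ (s : S) → ¬ _⊨_ xor-model s ([ ∁ first ] (¬' true-state))
second-unable-false-state _ (τ , forces) =
  forces negate-second (xor-not-self≡true (τ (suc zero) refl))
  where
  negate-second : ActC xor-model (∁ (∁ first))
  negate-second zero _ = not (τ (suc zero) refl)
  negate-second (suc zero) ()

theorem4p25 : Σ ℕ λ n → n ≥ 1 × Σ (Coalition n) λ C → Σ (Formula n) λ φ →
    Σ (CoalitionModel n) λ M → Σ (CoalitionModel.S M) λ s →
      _⊨_ M s (Iab C φ) × ¬ (_⊨_ M s ([ ∁ C ] (¬' φ)))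
theorem4p25 =
  2 , s≤s z≤n , first , true-state , xor-model , false ,
  first-unable-true-state false , second-unable-false-state false
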